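{- Let $k\ge 2$, $s_1,\dots,s_k\in\mathbb{N}$, and $n=R(s_1,\dots,s_k)$. Let $e$ be an edge of $K_n$ and suppose the edges of $K_n-e$ are colored with colors $\{1,\dots,k\}$ so that for no $t\in\{1,\dots,k\}$ is there a subgraph isomorphic to $K_{s_t}$ all of whose edges have color $t$. For $t\in\{1,\dots,k\}$, extend this coloring by giving $e$ color $t$, and let $G_t$ be the subgraph of $K_n$ whose vertices are the vertices of the copies of $K_{s_t}$ monochromatic in color $t$ that contain $e$, and whose edges are the edges of color $t$ incident to those vertices. Then for all $i,j\in\{1,\dots,k\}$ with $|V(G_i)|\ge|V(G_j)|$, $$\bigl|\,|V(G_i)|-|V(G_j)|\,\bigr|<R\bigl(s_i-1,\,R(s_1,\dots,s_{i-1},s_{i+1},\dots,s_k)\bigr)-(s_j-2).$$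
   Context: $K_n$ is the complete graph on $n$ vertices, $K_n-e$ is $K_n$ with the edge $e$ deleted. For $s_1,\dots,s_k\in\mathbb{N}$, the Ramsey number $R(s_1,\dots,s_k)$ is the smallest $n$ such that every coloring of the edges of $K_n$ with colors $\{1,\dots,k\}$ contains, for some $i$, a subgraph isomorphic to $K_{s_i}$ all of whose edges have color $i$. For a single argument, $R(s)=s$. -}

module Defs where

open import Data.Nat using (ℕ; zero; suc; pred; _≤_)
open import Data.Fin using (Fin; zero; suc; punchIn; _≟_)
open import Data.Fin.Subset using (Subset; _∈_)
open import Data.Product using (Σ; ∃; _×_; _,_)
open import Data.Sum using (_⊎_)
open import Function.Definitions using (Injective)
open import Relation.Binary.PropositionalEquality using (_≡_; _≢_)
open import Relation.Nullary using (¬_; yes; no)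
open import Relation.Nullary.Decidable using (_×-dec_; _⊎-dec_)
open import Data.Bool using (if_then_else_)
open import Relation.Nullary.Decidable using (⌊_⌋)

-- An edge colouring of K_n with k colours: a symmetric function on pairs of
-- vertices (the value on the diagonal is irrelevant).
record Colouring (n k : ℕ) : Set where
  field
    col  : Fin n → Fin n → Fin k
    sym  : ∀ x y → col x y ≡ col y x
open Colouring public

MonoClique : ∀ {n k} → (Fin n → Fin n → Fin k) → (s : ℕ) → Fin k → (Fin s → Fin n) → Set
MonoClique c s t f = Injective _≡_ _≡_ f × (∀ a b → a ≢ b → c (f a) (f b) ≡ t)

RamseyProp : ∀ {k} → (Fin k → ℕ) → ℕ → Set
RamseyProp {k} s n = (C : Colouring n k) →
  ∃ λ (i : Fin k) → ∃ λ (f : Fin (s i) → Fin n) → MonoClique (col C) (s i) i f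

IsRamsey : ∀ {k} → (Fin k → ℕ) → ℕ → Set
IsRamsey s n = RamseyProp s n × (∀ m → RamseyProp s m → n ≤ m)

removeAt : ∀ {k} → Fin k → (Fin k → ℕ) → Fin (pred k) → ℕ
removeAt {suc k} i s j = s (punchIn i j)

pair : ℕ → ℕ → Fin 2 → ℕ
pair a b zero = a
pair a b (suc _) = b

IsEdge : ∀ {n} → Fin n → Fin n → Fin n → Fin n → Set
IsEdge u v x y = (x ≡ u × y ≡ v) ⊎ (x ≡ v × y ≡ u)

extend : ∀ {n k} → (Fin n → Fin n → Fin k) → Fin n → Fin n → Fin k → Fin n → Fin n → Fin k
extend c u v t x y =
  if ⌊ ((x ≟ u) ×-dec (y ≟ v)) ⊎-dec ((x ≟ v) ×-dec (y ≟ u)) ⌋ then t else c x y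

AvoidsAll : ∀ {n k} → (Fin n → Fin n → Fin k) → Fin n → Fin n → (Fin k → ℕ) → Set
AvoidsAll {n} c u v s = ∀ t → ¬ (∃ λ (f : Fin (s t) → Fin n) →
  MonoClique c (s t) t f × (∀ a b → ¬ IsEdge u v (f a) (f b)))

InG : ∀ {n k} → (Fin n → Fin n → Fin k) → Fin n → Fin n → (Fin k → ℕ) → Fin k → Fin n → Set
InG {n} c u v s t x = ∃ λ (f : Fin (s t) → Fin n) →
  MonoClique (extend c u v t) (s t) t f ×
  (∃ λ a → f a ≡ u) × (∃ λ b → f b ≡ v) × (∃ λ d → f d ≡ x)

IsVG : ∀ {n k} → (Fin n → Fin n → Fin k) → Fin n → Fin n → (Fin k → ℕ) → Fin k → Subset n → Set
IsVG c u v s t S = ∀ x → (x ∈ S → InG c u v s t x) × (InG c u v s t x → x ∈ S)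

{-# OPTIONS --safe #-}

-- Recolouring e with colour j, the Ramsey property yields a K_{s_t} monochromatic in colour t;
-- it must contain e, since K_n - e has no such clique, so t = j and the clique lies in G_j:
-- hence s_j ≤ |V(G_j)|.  Every vertex of G_i other than the endpoints u, v of e is joined
-- to u by an edge of colour i, and there are fewer than r = R(s_i - 1, m) such neighbours
-- of u: among r of them there is either a K_{s_i - 1} of colour i, which together with u
-- is a K_{s_i} of colour i, or a K_m without colour i, hence a K_{s_t} of colour t ≠ i,
-- and neither contains v.  So s_j ≤ |V(G_j)| ≤ |V(G_i)| < r + 2.

module Submission where

open import Defs
open import Data.Nat using (ℕ; _≤_; _≥_)
open import Data.Fin using (Fin)
open import Data.Fin.Subset using (Subset; ∣_∣)
open import Data.Integer using (+_; _-_; _<_)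
open import Relation.Binary.PropositionalEquality using (_≢_)

open import Data.Empty using (⊥)
open import Data.Fin using (zero; suc; punchIn; punchOut; inject≤; _≟_)
import Data.Fin.Properties as Fin
open import Data.Fin.Subset using (_∈_; _⊆_; _∪_; ⁅_⁆; inside; outside)
open import Data.Fin.Subset.Properties using (p⊆q⇒∣p∣≤∣q∣; x∈p∪q⁺; x∈⁅x⁆; ∣⁅x⁆∣≡1)
open import Data.Integer using (_⊖_)
import Data.Integer as ℤ
import Data.Integer.Properties as ℤ
open import Data.Nat using (z≤n; s≤s; _+_; _∸_) renaming (_<_ to _<ℕ_)
import Data.Nat.Properties as ℕ
open import Data.Product using (∃; _×_; _,_; proj₁; proj₂)
open import Data.Sum using (_⊎_; inj₁; inj₂)
open import Data.Vec using (_∷_; []; here; there; tabulate)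
open import Data.Vec.Properties using (lookup∘tabulate; lookup⇒[]=; []=⇒lookup)
import Data.Vec.Functional as Vector
open import Function using (_∘_)
open import Function.Definitions using (Injective)
open import Relation.Binary.PropositionalEquality
  using (_≡_; refl; cong; cong₂; subst; subst₂; trans; module ≡-Reasoning)
import Relation.Binary.PropositionalEquality as ≡
open import Relation.Nullary using (¬_; Dec; yes; no; does; proof; Reflects; invert; contradiction)
open import Relation.Nullary.Decidable using (_×-dec_; _⊎-dec_; ¬?; dec-true)
open import Relation.Unary using (Decidable)

private
  variable
    k k′ m n q : ℕ

rank : (p : Subset n) {x : Fin n} → x ∈ p → Fin ∣ p ∣
rank (inside  ∷ p) here        = zero
rank (inside  ∷ p) (there x∈p) = suc (rank p x∈p)
rank (outside ∷ p) (there x∈p) = rank p x∈p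

rank-injective : (p : Subset n) {x y : Fin n} (x∈p : x ∈ p) (y∈p : y ∈ p) →
  rank p x∈p ≡ rank p y∈p → x ≡ y
rank-injective (inside  ∷ p) here        here        _  = refl
rank-injective (inside  ∷ p) (there x∈p) (there y∈p) eq =
  cong suc (rank-injective p x∈p y∈p (Fin.suc-injective eq))
rank-injective (outside ∷ p) (there x∈p) (there y∈p) eq =
  cong suc (rank-injective p x∈p y∈p eq)

element : (p : Subset n) → Fin ∣ p ∣ → Fin n
element (inside  ∷ p) zero    = zero
element (inside  ∷ p) (suc a) = suc (element p a)
element (outside ∷ p) a       = suc (element p a)

element-∈ : (p : Subset n) (a : Fin ∣ p ∣) → element p a ∈ p
element-∈ (inside  ∷ p) zero    = here
element-∈ (inside  ∷ p) (suc a) = there (element-∈ p a)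
element-∈ (outside ∷ p) a       = there (element-∈ p a)

element-injective : (p : Subset n) → Injective _≡_ _≡_ (element p)
element-injective (inside  ∷ p) {zero}  {zero}  _  = refl
element-injective (inside  ∷ p) {suc a} {suc b} eq =
  cong suc (element-injective p (Fin.suc-injective eq))
element-injective (outside ∷ p) eq = element-injective p (Fin.suc-injective eq)

injective⇒≤∣p∣ : (p : Subset n) {f : Fin m → Fin n} → Injective _≡_ _≡_ f →
  (∀ a → f a ∈ p) → m ≤ ∣ p ∣
injective⇒≤∣p∣ p f-inj f∈p =
  Fin.injective⇒≤ (λ eq → f-inj (rank-injective p (f∈p _) (f∈p _) eq))

≤∣p∣⇒injective : (p : Subset n) → m ≤ ∣ p ∣ →
  ∃ λ (f : Fin m → Fin n) → Injective _≡_ _≡_ f × (∀ a → f a ∈ p)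
≤∣p∣⇒injective {m = m} p m≤∣p∣ =
  element p ∘ inject≤′ ,
  (λ eq → Fin.inject≤-injective m≤∣p∣ m≤∣p∣ _ _ (element-injective p eq)) ,
  (λ a → element-∈ p (inject≤′ a))
  where
  inject≤′ : Fin m → Fin ∣ p ∣
  inject≤′ a = inject≤ a m≤∣p∣

∣p∪q∣≤∣p∣+∣q∣ : (p q : Subset n) → ∣ p ∪ q ∣ ≤ ∣ p ∣ + ∣ q ∣
∣p∪q∣≤∣p∣+∣q∣ []            []            = z≤n
∣p∪q∣≤∣p∣+∣q∣ (inside  ∷ p) (inside  ∷ q) =
  s≤s (ℕ.≤-trans (∣p∪q∣≤∣p∣+∣q∣ p q) (ℕ.+-monoʳ-≤ ∣ p ∣ (ℕ.n≤1+n ∣ q ∣)))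
∣p∪q∣≤∣p∣+∣q∣ (inside  ∷ p) (outside ∷ q) = s≤s (∣p∪q∣≤∣p∣+∣q∣ p q)
∣p∪q∣≤∣p∣+∣q∣ (outside ∷ p) (inside  ∷ q) =
  ℕ.≤-trans (s≤s (∣p∪q∣≤∣p∣+∣q∣ p q)) (ℕ.≤-reflexive (≡.sym (ℕ.+-suc ∣ p ∣ ∣ q ∣)))
∣p∪q∣≤∣p∣+∣q∣ (outside ∷ p) (outside ∷ q) = ∣p∪q∣≤∣p∣+∣q∣ p q

select : {P : Fin n → Set} → Decidable P → Subset n
select P? = tabulate (does ∘ P?)

x∈select⁺ : {P : Fin n → Set} (P? : Decidable P) {x : Fin n} → P x → x ∈ select P?
x∈select⁺ P? {x} px = lookup⇒[]= x _ (trans (lookup∘tabulate _ x) (dec-true (P? x) px))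

x∈select⁻ : {P : Fin n → Set} (P? : Decidable P) {x : Fin n} → x ∈ select P? → P x
x∈select⁻ P? {x} x∈ =
  invert (subst (Reflects _) (trans (≡.sym (lookup∘tabulate _ x)) ([]=⇒lookup x∈)) (proof (P? x)))

isEdge? : (u v x y : Fin n) → Dec (IsEdge u v x y)
isEdge? u v x y = ((x ≟ u) ×-dec (y ≟ v)) ⊎-dec ((x ≟ v) ×-dec (y ≟ u))

IsEdge-swap : {u v x y : Fin n} → IsEdge u v x y → IsEdge u v y x
IsEdge-swap (inj₁ (x≡u , y≡v)) = inj₂ (y≡v , x≡u)
IsEdge-swap (inj₂ (x≡v , y≡u)) = inj₁ (y≡u , x≡v)

module _ (c : Fin n → Fin n → Fin k) (u v : Fin n) (t : Fin k) {x y : Fin n} where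

  extend-edge : IsEdge u v x y → extend c u v t x y ≡ t
  extend-edge e with isEdge? u v x y
  ... | yes _ = refl
  ... | no ¬e = contradiction e ¬e

  extend-nonEdge : ¬ IsEdge u v x y → extend c u v t x y ≡ c x y
  extend-nonEdge ¬e with isEdge? u v x y
  ... | yes e = contradiction e ¬e
  ... | no _  = refl

extendColouring : Colouring n k → Fin n → Fin n → Fin k → Colouring n k
extendColouring C u v t = record { col = extend (col C) u v t ; sym = extend-sym }
  where
  extend-sym : ∀ x y → extend (col C) u v t x y ≡ extend (col C) u v t y x
  extend-sym x y = by-cases (isEdge? u v x y)
    where
    by-cases : Dec (IsEdge u v x y) → extend (col C) u v t x y ≡ extend (col C) u v t y x
    by-cases (yes e) = begin
      extend (col C) u v t x y  ≡⟨ extend-edge (col C) u v t e ⟩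
      t                         ≡⟨ extend-edge (col C) u v t (IsEdge-swap e) ⟨
      extend (col C) u v t y x  ∎
      where open ≡-Reasoning
    by-cases (no ¬e) = begin
      extend (col C) u v t x y  ≡⟨ extend-nonEdge (col C) u v t ¬e ⟩
      col C x y                 ≡⟨ Colouring.sym C x y ⟩
      col C y x                 ≡⟨ extend-nonEdge (col C) u v t (¬e ∘ IsEdge-swap) ⟨
      extend (col C) u v t y x  ∎
      where open ≡-Reasoning

NoEdge : Fin n → Fin n → (Fin q → Fin n) → Set
NoEdge u v f = ∀ a b → ¬ IsEdge u v (f a) (f b)

missing⇒NoEdge : {u v : Fin n} {f : Fin q → Fin n} →
  (∀ a → f a ≢ u) ⊎ (∀ a → f a ≢ v) → NoEdge u v f
missing⇒NoEdge (inj₁ ∌u) a b (inj₁ (fa≡u , _)) = ∌u a fa≡u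
missing⇒NoEdge (inj₁ ∌u) a b (inj₂ (_ , fb≡u)) = ∌u b fb≡u
missing⇒NoEdge (inj₂ ∌v) a b (inj₁ (_ , fb≡v)) = ∌v b fb≡v
missing⇒NoEdge (inj₂ ∌v) a b (inj₂ (fa≡v , _)) = ∌v a fa≡v

MonoClique-extend⁻ : {c : Fin n → Fin n → Fin k} {u v : Fin n} {t t′ : Fin k} {f : Fin q → Fin n} →
  NoEdge u v f → MonoClique (extend c u v t′) q t f → MonoClique c q t f
MonoClique-extend⁻ {c = c} {u} {v} {t′ = t′} noEdge (f-inj , mono) =
  f-inj , λ a b a≢b → trans (≡.sym (extend-nonEdge c u v t′ (noEdge a b))) (mono a b a≢b)

MonoClique-∷ : (C : Colouring n k) {t : Fin k} {w : Fin n} {f : Fin q → Fin n} →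
  MonoClique (col C) q t f → (∀ a → f a ≢ w) → (∀ a → col C w (f a) ≡ t) →
  MonoClique (col C) (1 + q) t (w Vector.∷ f)
MonoClique-∷ C {t} {w} {f} (f-inj , mono) ∌w w-f = inj , mono′
  where
  inj : Injective _≡_ _≡_ (w Vector.∷ f)
  inj {zero}  {zero}  _      = refl
  inj {zero}  {suc b} w≡fb   = contradiction (≡.sym w≡fb) (∌w b)
  inj {suc a} {zero}  fa≡w   = contradiction fa≡w (∌w a)
  inj {suc a} {suc b} fa≡fb  = cong suc (f-inj fa≡fb)
  mono′ : ∀ a b → a ≢ b → col C ((w Vector.∷ f) a) ((w Vector.∷ f) b) ≡ t
  mono′ zero    zero    0≢0 = contradiction refl 0≢0
  mono′ zero    (suc b) _   = w-f b
  mono′ (suc a) zero    _   = trans (Colouring.sym C (f a) w) (w-f a)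
  mono′ (suc a) (suc b) a≢b = mono a b (a≢b ∘ cong suc)

restrict : Colouring n k → (Fin m → Fin n) → Colouring m k
restrict C h = record
  { col = λ a b → col C (h a) (h b)
  ; sym = λ a b → Colouring.sym C (h a) (h b)
  }

recolour : (Fin k → Fin k′) → Colouring n k → Colouring n k′
recolour φ C = record
  { col = λ x y → φ (col C x y)
  ; sym = λ x y → cong φ (Colouring.sym C x y)
  }

MonoClique-restrict : (C : Colouring n k) {h : Fin m → Fin n} {t : Fin k} {g : Fin q → Fin m} →
  Injective _≡_ _≡_ h → MonoClique (col (restrict C h)) q t g → MonoClique (col C) q t (h ∘ g)
MonoClique-restrict C h-inj (g-inj , mono) = g-inj ∘ h-inj , mono

MonoClique-recolour : (C : Colouring n k) {φ : Fin k → Fin k′} {t : Fin k} {t′ : Fin k′}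
  {g : Fin q → Fin n} →
  (∀ {x} → φ x ≡ t′ → x ≡ t) → MonoClique (col (recolour φ C)) q t′ g → MonoClique (col C) q t g
MonoClique-recolour C φ⁻¹ (g-inj , mono) = g-inj , λ a b a≢b → φ⁻¹ (mono a b a≢b)

-- Colour zero stands for i, matching the first entry of pair (s i ∸ 1) m.
hasColour : Fin k → Fin k → Fin 2
hasColour i x with x ≟ i
... | yes _ = zero
... | no  _ = suc zero

hasColour-zero : {i x : Fin k} → hasColour i x ≡ zero → x ≡ i
hasColour-zero {i = i} {x} eq with x ≟ i
... | yes x≡i = x≡i

hasColour-one : {i x : Fin k} → hasColour i x ≡ suc zero → x ≢ i
hasColour-one {i = i} {x} eq with x ≟ i
... | no x≢i = x≢i

-- The value at x = i is arbitrary: dropColour i is only applied to colours other than i.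
dropColour : Fin (2 + k) → Fin (2 + k) → Fin (1 + k)
dropColour i x with x ≟ i
... | yes _   = zero
... | no  x≢i = punchOut (x≢i ∘ ≡.sym)

punchIn-dropColour : {i x : Fin (2 + k)} → x ≢ i → punchIn i (dropColour i x) ≡ x
punchIn-dropColour {i = i} {x} x≢i with x ≟ i
... | yes x≡i = contradiction x≡i x≢i
... | no  _   = Fin.punchIn-punchOut _

module _ (c : Fin n → Fin n → Fin k) {u v : Fin n} {s : Fin k → ℕ} (av : AvoidsAll c u v s) where

  -- Stated for sizes q merely equal to s t, such as 1 + (s t ∸ 1).
  avoidsAll-≡ : {t : Fin k} → q ≡ s t → (f : Fin q → Fin n) → MonoClique c q t f → ¬ NoEdge u v f
  avoidsAll-≡ refl f clique noEdge = av _ (f , clique , noEdge)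

  avoidsAll⇒0<s : ∀ t → 0 <ℕ s t
  avoidsAll⇒0<s t = ℕ.n≢0⇒n>0 λ s≡0 →
    avoidsAll-≡ (≡.sym s≡0) (λ ()) ((λ { {()} }) , λ ()) (λ ())

  extendedClique-¬NoEdge : {t t′ : Fin k} {f : Fin (s t) → Fin n} →
    MonoClique (extend c u v t′) (s t) t f → ¬ NoEdge u v f
  extendedClique-¬NoEdge clique noEdge =
    av _ (_ , MonoClique-extend⁻ {c = c} noEdge clique , noEdge)

  extendedClique-endpoints : {t t′ : Fin k} {f : Fin (s t) → Fin n} →
    MonoClique (extend c u v t′) (s t) t f → (∃ λ a → f a ≡ u) × (∃ λ b → f b ≡ v)
  extendedClique-endpoints {f = f} clique
    with Fin.any? (λ a → f a ≟ u) | Fin.any? (λ b → f b ≟ v)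
  ... | yes ∋u | yes ∋v = ∋u , ∋v
  ... | no ∌u  | _      =
    contradiction (missing⇒NoEdge (inj₁ λ a fa≡u → ∌u (a , fa≡u))) (extendedClique-¬NoEdge clique)
  ... | yes _  | no ∌v  =
    contradiction (missing⇒NoEdge (inj₂ λ b fb≡v → ∌v (b , fb≡v))) (extendedClique-¬NoEdge clique)

extendedClique-colour : (c : Fin n → Fin n → Fin k) {u v : Fin n} {t t′ : Fin k}
  {f : Fin q → Fin n} →
  u ≢ v → MonoClique (extend c u v t′) q t f → ∀ {a b} → f a ≡ u → f b ≡ v → t ≡ t′
extendedClique-colour c {u} {v} {t} {t′} {f} u≢v (_ , mono) {a} {b} fa≡u fb≡v = begin
  t                              ≡⟨ mono a b a≢b ⟨
  extend c u v t′ (f a) (f b)    ≡⟨ extend-edge c u v t′ (inj₁ (fa≡u , fb≡v)) ⟩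
  t′                             ∎
  where
  open ≡-Reasoning
  a≢b : a ≢ b
  a≢b refl = u≢v (trans (≡.sym fa≡u) fb≡v)

InG⇒extend-u≡ : (c : Fin n → Fin n → Fin k) {u v : Fin n} {s : Fin k → ℕ} {t : Fin k} {x : Fin n} →
  InG c u v s t x → x ≢ u → extend c u v t u x ≡ t
InG⇒extend-u≡ c {u} {v} {t = t} (f , (_ , mono) , (a , fa≡u) , _ , (d , fd≡x)) x≢u =
  subst₂ (λ y z → extend c u v t y z ≡ t) fa≡u fd≡x (mono a d a≢d)
  where
  a≢d : a ≢ d
  a≢d refl = x≢u (trans (≡.sym fd≡x) fa≡u)

s≤∣VG∣ : {s : Fin k → ℕ} → RamseyProp s n → (C : Colouring n k) {u v : Fin n} → u ≢ v →
  AvoidsAll (col C) u v s → ∀ {j S} → IsVG (col C) u v s j S → s j ≤ ∣ S ∣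
s≤∣VG∣ ramsey C {u} {v} u≢v av {j} {S} vg with ramsey (extendColouring C u v j)
... | t , f , clique with extendedClique-endpoints (col C) av clique
... | (a , fa≡u) , (b , fb≡v) with extendedClique-colour (col C) u≢v clique fa≡u fb≡v
... | refl = injective⇒≤∣p∣ S (proj₁ clique)
  (λ d → proj₂ (vg (f d)) (f , clique , (a , fa≡u) , (b , fb≡v) , d , refl))

module _ (C : Colouring n (2 + k)) {u v : Fin n} (u≢v : u ≢ v) {s : Fin (2 + k) → ℕ}
         (av : AvoidsAll (col C) u v s) (i : Fin (2 + k)) where

  Neighbour : Fin n → Set
  Neighbour x = x ≢ u × x ≢ v × col C u x ≡ i

  neighbour? : Decidable Neighbour
  neighbour? x = ¬? (x ≟ u) ×-dec ¬? (x ≟ v) ×-dec (col C u x ≟ i)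

  neighbours : Subset n
  neighbours = select neighbour?

  VG⊆neighbours∪⁅u⁆∪⁅v⁆ : ∀ {S} → IsVG (col C) u v s i S → S ⊆ neighbours ∪ (⁅ u ⁆ ∪ ⁅ v ⁆)
  VG⊆neighbours∪⁅u⁆∪⁅v⁆ vg {x} x∈S with x ≟ u | x ≟ v
  ... | yes refl | _        = x∈p∪q⁺ (inj₂ (x∈p∪q⁺ (inj₁ (x∈⁅x⁆ x))))
  ... | no _     | yes refl = x∈p∪q⁺ (inj₂ (x∈p∪q⁺ (inj₂ (x∈⁅x⁆ x))))
  ... | no x≢u   | no x≢v   = x∈p∪q⁺ (inj₁ (x∈select⁺ neighbour? (x≢u , x≢v , ux-colour)))
    where
    ¬IsEdge-ux : ¬ IsEdge u v u x
    ¬IsEdge-ux (inj₁ (_ , x≡v)) = x≢v x≡v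
    ¬IsEdge-ux (inj₂ (u≡v , _)) = u≢v u≡v
    ux-colour : col C u x ≡ i
    ux-colour = trans (≡.sym (extend-nonEdge (col C) u v i ¬IsEdge-ux))
                      (InG⇒extend-u≡ (col C) {s = s} (proj₁ (vg x) x∈S) x≢u)

  ∣VG∣≤∣neighbours∣+2 : ∀ {S} → IsVG (col C) u v s i S → ∣ S ∣ ≤ ∣ neighbours ∣ + 2
  ∣VG∣≤∣neighbours∣+2 {S} vg = begin
    ∣ S ∣                                     ≤⟨ p⊆q⇒∣p∣≤∣q∣ (VG⊆neighbours∪⁅u⁆∪⁅v⁆ vg) ⟩
    ∣ neighbours ∪ (⁅ u ⁆ ∪ ⁅ v ⁆) ∣          ≤⟨ ∣p∪q∣≤∣p∣+∣q∣ neighbours _ ⟩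
    ∣ neighbours ∣ + ∣ ⁅ u ⁆ ∪ ⁅ v ⁆ ∣
      ≤⟨ ℕ.+-monoʳ-≤ ∣ neighbours ∣ (∣p∪q∣≤∣p∣+∣q∣ ⁅ u ⁆ ⁅ v ⁆) ⟩
    ∣ neighbours ∣ + (∣ ⁅ u ⁆ ∣ + ∣ ⁅ v ⁆ ∣)
      ≡⟨ cong₂ (λ a b → ∣ neighbours ∣ + (a + b)) (∣⁅x⁆∣≡1 u) (∣⁅x⁆∣≡1 v) ⟩
    ∣ neighbours ∣ + 2                        ∎
    where open ℕ.≤-Reasoning

  ¬neighbourClique : (g : Fin (s i ∸ 1) → Fin n) → MonoClique (col C) (s i ∸ 1) i g →
    (∀ a → Neighbour (g a)) → ⊥
  ¬neighbourClique g clique nb =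
    avoidsAll-≡ (col C) av (ℕ.m+[n∸m]≡n (avoidsAll⇒0<s (col C) av i)) (u Vector.∷ g)
      (MonoClique-∷ C clique (proj₁ ∘ nb) (proj₂ ∘ proj₂ ∘ nb))
      (missing⇒NoEdge (inj₂ ∌v))
    where
    ∌v : ∀ a → (u Vector.∷ g) a ≢ v
    ∌v zero    = u≢v
    ∌v (suc a) = proj₁ (proj₂ (nb a))

  ¬i-freeClique : RamseyProp (removeAt i s) m → (g : Fin m → Fin n) → Injective _≡_ _≡_ g →
    (∀ a b → a ≢ b → col C (g a) (g b) ≢ i) → (∀ a → g a ≢ v) → ⊥
  ¬i-freeClique ramsey g g-inj ¬i ∌v with ramsey (recolour (dropColour i) (restrict C g))
  ... | j , h , h-inj , mono =
    av (punchIn i j) (g ∘ h , (h-inj ∘ g-inj , mono′) , missing⇒NoEdge (inj₂ (∌v ∘ h)))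
    where
    open ≡-Reasoning
    mono′ : ∀ a b → a ≢ b → col C (g (h a)) (g (h b)) ≡ punchIn i j
    mono′ a b a≢b = begin
      col C (g (h a)) (g (h b))
        ≡⟨ punchIn-dropColour (¬i (h a) (h b) (a≢b ∘ h-inj)) ⟨
      punchIn i (dropColour i (col C (g (h a)) (g (h b))))
        ≡⟨ cong (punchIn i) (mono a b a≢b) ⟩
      punchIn i j
        ∎

  ¬injection-into-neighbours : ∀ {m r} → RamseyProp (removeAt i s) m →
    RamseyProp (pair (s i ∸ 1) m) r →
    (h : Fin r → Fin n) → Injective _≡_ _≡_ h → (∀ a → h a ∈ neighbours) → ⊥
  ¬injection-into-neighbours ramseyₘ ramseyᵣ h h-inj h∈
    with ramseyᵣ (recolour (hasColour i) (restrict C h))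
  ... | zero , g , clique =
    ¬neighbourClique (h ∘ g)
      (MonoClique-restrict C h-inj (MonoClique-recolour (restrict C h) hasColour-zero clique))
      (x∈select⁻ neighbour? ∘ h∈ ∘ g)
  ... | suc zero , g , g-inj , mono =
    ¬i-freeClique ramseyₘ (h ∘ g) (g-inj ∘ h-inj) (λ a b a≢b → hasColour-one (mono a b a≢b))
      (proj₁ ∘ proj₂ ∘ x∈select⁻ neighbour? ∘ h∈ ∘ g)

  ∣neighbours∣<r : ∀ {m r} → RamseyProp (removeAt i s) m → RamseyProp (pair (s i ∸ 1) m) r →
    ∣ neighbours ∣ <ℕ r
  ∣neighbours∣<r ramseyₘ ramseyᵣ = ℕ.≰⇒> λ r≤∣neighbours∣ →
    let h , h-inj , h∈ = ≤∣p∣⇒injective neighbours r≤∣neighbours∣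
    in  ¬injection-into-neighbours ramseyₘ ramseyᵣ h h-inj h∈

+m-+n≡+[m∸n] : ∀ {m n} → n ≤ m → + m - + n ≡ + (m ∸ n)
+m-+n≡+[m∸n] {m} {n} n≤m = trans (ℤ.m-n≡m⊖n m n) (ℤ.⊖-≥ n≤m)

+m-[+n-+2]≡+[m+2∸n] : ∀ m n → n ≤ m + 2 → + m - (+ n - + 2) ≡ + (m + 2 ∸ n)
+m-[+n-+2]≡+[m+2∸n] m n n≤m+2 = begin
  + m - (+ n - + 2)      ≡⟨ cong (λ z → + m ℤ.+ ℤ.- z) (ℤ.m-n≡m⊖n n 2) ⟩
  + m ℤ.+ ℤ.- (n ⊖ 2)    ≡⟨ cong (λ z → + m ℤ.+ z) (ℤ.⊖-swap 2 n) ⟨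
  + m ℤ.+ (2 ⊖ n)        ≡⟨ ℤ.distribʳ-⊖-+-pos m 2 n ⟩
  m + 2 ⊖ n              ≡⟨ ℤ.⊖-≥ n≤m+2 ⟩
  + (m + 2 ∸ n)          ∎
  where open ≡-Reasoning

gap-bound : ∀ {a b c r} → c ≤ b → b ≤ a → a <ℕ r + 2 →
  + Data.Integer.∣ + a - + b ∣ < + r - (+ c - + 2)
gap-bound {a} {b} {c} {r} c≤b b≤a a<r+2 =
  subst₂ _<_ (cong (+_ ∘ Data.Integer.∣_∣) (≡.sym (+m-+n≡+[m∸n] b≤a)))
             (≡.sym (+m-[+n-+2]≡+[m+2∸n] r c c≤r+2))
    (ℤ.+<+ (ℕ.≤-<-trans (ℕ.∸-monoʳ-≤ a c≤b) (ℕ.∸-monoˡ-< a<r+2 c≤a)))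
  where
  c≤a : c ≤ a
  c≤a = ℕ.≤-trans c≤b b≤a
  c≤r+2 : c ≤ r + 2
  c≤r+2 = ℕ.≤-trans c≤a (ℕ.<⇒≤ a<r+2)

lemma3p6 : (k : ℕ) → 2 ≤ k → (s : Fin k → ℕ) → (n : ℕ) → IsRamsey s n →
    (u v : Fin n) → u ≢ v →
    (C : Colouring n k) → AvoidsAll (col C) u v s →
    (i j : Fin k) → (Si Sj : Subset n) →
    IsVG (col C) u v s i Si → IsVG (col C) u v s j Sj →
    ∣ Si ∣ ≥ ∣ Sj ∣ →
    (m r : ℕ) → IsRamsey (removeAt i s) m → IsRamsey (pair (s i Data.Nat.∸ 1) m) r →
    + Data.Integer.∣ + ∣ Si ∣ - + ∣ Sj ∣ ∣ < + r - (+ s j - + 2)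
lemma3p6 _ (s≤s (s≤s z≤n)) s _ (ramseyₙ , _) _ _ u≢v C av i _ Si _ vgᵢ vgⱼ ∣Sj∣≤∣Si∣ _ r
         (ramseyₘ , _) (ramseyᵣ , _) =
  gap-bound (s≤∣VG∣ ramseyₙ C u≢v av vgⱼ) ∣Sj∣≤∣Si∣ ∣Si∣<r+2
  where
  ∣Si∣<r+2 : ∣ Si ∣ <ℕ r + 2
  ∣Si∣<r+2 = ℕ.≤-<-trans (∣VG∣≤∣neighbours∣+2 C u≢v av i vgᵢ)
                         (ℕ.+-monoˡ-< 2 (∣neighbours∣<r C u≢v av i ramseyₘ ramseyᵣ))
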